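{- Let $n\ge 2$, $1\le t\le n-1$, $N=2^n-1$, $T=2^t-1$, $M=2^{n-t}-1$. Let $C$ be the binary code of length $N$ with parity check matrix $H_{n,t}$ (columns ordered lexicographically), let $\mathcal{D}$ be the triple system on $V=\{1,\dots,N\}$ whose blocks are the supports of all weight-$3$ codewords of $C$, let $V_0\subseteq V$ be the set of indices of the zero columns of $H_{n,t}$, and let $G_1,\dots,G_M$ be the groups (the classes of indices of identical nonzero columns). Then the block set of $\mathcal{D}$ splits as follows: (1) the blocks contained in $V_0$ form the complete $2$-$(T,3,T-2)$ design on $V_0$ (i.e. they are all $3$-subsets of $V_0$); (2) the blocks disjoint from $V_0$ form a group divisible design with the $M$ groups $G_1,\dots,G_M$ of size $T+1$ each, in which two points of the same group lie in no common block and two points of different groups lie in exactly $T+1$ common blocks; (3) every other block contains two points of the same group and exactly one point of $V_0$, and any two points in the same group lie in exactly $T$ blocks of this type.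
   Context: $H_{n,t}$ is the $(n-t)\times(2^n-1)$ binary matrix obtained from the matrix $H_n$ (whose columns are all distinct nonzero vectors of $\mathrm{GF}(2)^n$) by deleting $t$ rows; its columns consist of every nonzero vector of $\mathrm{GF}(2)^{n-t}$ exactly $2^t=T+1$ times and the zero vector exactly $T$ times. $C=\{c\in\mathrm{GF}(2)^N:H_{n,t}c^T=0\}$. For a nonzero $u\in\mathrm{GF}(2)^{n-t}$, the corresponding group is the set of column indices whose column equals $u$; so $|V_0|=T$ and each group has size $T+1$. A group divisible design with groups $G_1,\dots,G_M$ is an incidence structure on the union of the groups in which any two points of the same group lie in $\lambda_1$ blocks and any two points of different groups lie in $\lambda_2$ blocks. -}

module Defs where

open import Data.Bool using (Bool; true; false; _∧_; _∨_; not; _xor_)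
open import Data.Bool.Properties using () renaming (_≟_ to _≟ᵇ_)
open import Data.Nat using (ℕ; zero; suc; _∸_; _^_; _%_; _/_; _≡ᵇ_)
open import Data.Fin using (Fin; toℕ)
open import Data.Vec using (Vec; []; _∷_; lookup; tabulate; reverse)
open import Data.List using (List; length; filterᵇ; map; _++_) renaming ([] to []ₗ; _∷_ to _∷ₗ_)
open import Data.Fin.Subset using (Subset; ∣_∣)
open import Relation.Nullary.Decidable using (⌊_⌋)
import Data.Vec.Functional as VF

allᶠ : ∀ {m} → (Fin m → Bool) → Bool
allᶠ = VF.foldr _∧_ true

parity : ∀ {m} → (Fin m → Bool) → Bool
parity = VF.foldr _xor_ false

eqᵇ : Bool → Bool → Bool
eqᵇ a b = ⌊ a ≟ᵇ b ⌋

allSubsets : (m : ℕ) → List (Subset m)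
allSubsets zero    = [] ∷ₗ []ₗ
allSubsets (suc m) = map (true ∷_) (allSubsets m) ++ map (false ∷_) (allSubsets m)

countSubsets : ∀ {m} → (Subset m → Bool) → ℕ
countSubsets {m} p = length (filterᵇ p (allSubsets m))

bitsLSB : (n : ℕ) → ℕ → Vec Bool n
bitsLSB zero    m = []
bitsLSB (suc n) m = (m % 2 ≡ᵇ 1) ∷ bitsLSB n (m / 2)

-- column j (0-based) of H_n: the binary expansion of j+1, row 0 being the
-- most significant bit.  Columns 0,1,..,2^n-2 are then all nonzero vectors
-- of GF(2)^n in lexicographic order.
Hn : (n : ℕ) → Fin n → Fin (2 ^ n ∸ 1) → Bool
Hn n r j = lookup (reverse (bitsLSB n (suc (toℕ j)))) r

-- H_{n,t}: keep the rows κ(0) < ... < κ(n-t-1) of H_n (i.e. delete t rows)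

module Setup (n t : ℕ) (κ : Fin (n ∸ t) → Fin n) where

  N T : ℕ
  N = 2 ^ n ∸ 1
  T = 2 ^ t ∸ 1

  Hnt : Fin (n ∸ t) → Fin N → Bool
  Hnt i j = Hn n (κ i) j

  isCodeword : (Fin N → Bool) → Bool
  isCodeword c = allᶠ (λ i → not (parity (λ j → Hnt i j ∧ c j)))

  isBlock : Subset N → Bool
  isBlock B = (∣ B ∣ ≡ᵇ 3) ∧ isCodeword (lookup B)

  V0 : Subset N
  V0 = tabulate (λ j → allᶠ (λ i → not (Hnt i j)))

  group : (Fin (n ∸ t) → Bool) → Subset N
  group u = tabulate (λ j → allᶠ (λ i → eqᵇ (Hnt i j) (u i)))

  sameGroup : Fin N → Fin N → Bool
  sameGroup x y = not (lookup V0 x) ∧ allᶠ (λ i → eqᵇ (Hnt i x) (Hnt i y))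

  disjointV0 : Subset N → Bool
  disjointV0 B = allᶠ (λ j → not (lookup B j ∧ lookup V0 j))

  insideV0 : Subset N → Bool
  insideV0 B = allᶠ (λ j → not (lookup B j) ∨ lookup V0 j)

  otherBlock : Subset N → Bool
  otherBlock B = isBlock B ∧ not (insideV0 B) ∧ not (disjointV0 B)

-- A 3-subset {x, y, z} of column indices supports a codeword exactly when column z is the
-- sum of columns x and y, so the blocks through two points x, y are counted by their third
-- points.  Three zero columns sum to zero, hence every 3-subset of V0 is a block.  For x, y in
-- different groups the column sum is a nonzero vector u, and the third points are exactly the
-- 2^t = T + 1 points of the group of u.  For x, y in the same group the column sum is zero, so
-- the third point ranges over the T points of V0.  A block meeting V0 without lying in it has
-- exactly one point in V0, since two zero columns would force the third to be zero as well,
-- and then its other two points have equal columns.  The group sizes come from counting binary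
-- vectors: of the 2^n vectors of length n, exactly 2^t take prescribed values on the n − t
-- rows that are kept.
module Submission where

open import Defs
open import Algebra.Bundles using (CommutativeMonoid; CommutativeRing)
import Algebra.Properties.CommutativeMonoid.Sum as MonoidSum
open import Data.Bool using (Bool; true; false; _∧_; _∨_; not; _xor_; if_then_else_)
open import Data.Bool.Properties
  using ( ∧-commutativeMonoid; xor-∧-commutativeRing; ∧-conicalˡ; ∧-conicalʳ; ∧-identityʳ; ∧-zeroʳ; ∧-idem; ∧-assoc
        ; ∨-zeroʳ; xor-same; xor-identityʳ; ¬-not; not-injective; not-involutive)
  renaming (_≟_ to _≟ᵇ_; T-≡ to T⇔≡true)
open import Data.Fin using (Fin; zero; suc; toℕ; punchIn; punchOut; opposite; fromℕ; inject₁) renaming (_<_ to _<ᶠ_)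
open import Data.Fin.Properties
  using ( punchInᵢ≢i; punchIn-punchOut; punchIn-injective; punchOut-injective; injective⇒≤; any?
        ; opposite-involutive; <-cmp; <⇒≢)
  renaming (_≟_ to _≟ᶠ_)
open import Data.Fin.Subset using (Subset; ∣_∣; _⊆_; _∈_; _∩_; inside; outside)
open import Data.Fin.Subset.Properties using (drop-∷-⊆; p⊆q⇒∣p∣≤∣q∣)
open import Data.List using (List; length; filterᵇ; map; _++_) renaming ([] to []ₗ; _∷_ to _∷ₗ_)
open import Data.List.Properties using (length-++; filter-++)
open import Data.Nat using (ℕ; zero; suc; _+_; _*_; _/_; _∸_; _^_; _≤_; _<_; z≤n; s≤s; _≡ᵇ_)
open import Data.Nat.Properties
  using ( +-0-commutativeMonoid; +-comm; +-assoc; +-identityʳ; *-suc; +-∸-assoc; m∸[m∸n]≡n; m^n>0; m∸n+n≡m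
        ; ≤-trans; ≤-reflexive; <⇒≤; 1+n≰n; suc-injective; ≡ᵇ⇒≡)
open import Data.Nat.DivMod using ([m+kn]%n≡m%n; m*n%n≡0; m*n/n≡m; +-distrib-/)
open import Data.Product using (_×_; _,_; proj₁; proj₂; ∃-syntax)
open import Data.Sum using (_⊎_; inj₁; inj₂)
open import Data.Vec using (Vec; []; _∷_; _∷ʳ_; lookup; tabulate; reverse; replicate; here)
open import Data.Vec.Properties
  using ( lookup∘tabulate; lookup⇒[]=; []=⇒lookup; ∷-injectiveʳ; ≡-dec; lookup-zipWith; tabulate-cong
        ; reverse-∷; lookup-replicate)
open import Function using (_∘_; Equivalence)
open import Function.Definitions using (Injective)
open import Relation.Binary.PropositionalEquality
  using (_≡_; _≢_; _≗_; refl; sym; trans; cong; cong₂; subst; ≢-sym; module ≡-Reasoning)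
open import Relation.Nullary using (¬_; Dec; yes; no; contradiction)
open import Relation.Nullary.Decidable using (does; dec-true; dec-false)
open import Relation.Nullary.Decidable.Core using (T?)
open import Relation.Binary.Definitions using (tri<; tri≈; tri>)

module TripleSum {c ℓ} (M : CommutativeMonoid c ℓ) where
  open CommutativeMonoid M
    using (Carrier; _≈_; _∙_; ε; ∙-cong; ∙-congˡ; identityˡ; identityʳ; setoid)
    renaming (trans to ≈-trans; sym to ≈-sym; reflexive to ≈-reflexive)
  open MonoidSum M
  open import Relation.Binary.Reasoning.Setoid setoid

  sum-zero : ∀ {m} {f : Fin m → Carrier} → (∀ j → f j ≈ ε) → sum f ≈ ε
  sum-zero {m} f≈ε = ≈-trans (sum-cong-≋ f≈ε) (sum-replicate-zero m)

  sum-single : ∀ {m} {f : Fin m → Carrier} (x : Fin m) → (∀ j → j ≢ x → f j ≈ ε) → sum f ≈ f x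
  sum-single {suc m} {f} x vanish = begin
    sum f                       ≈⟨ sum-remove f ⟩
    f x ∙ sum (f ∘ punchIn x)   ≈⟨ ∙-congˡ (sum-zero (λ j → vanish (punchIn x j) (punchInᵢ≢i x j))) ⟩
    f x ∙ ε                     ≈⟨ identityʳ (f x) ⟩
    f x                         ∎

  private
    restrict : ∀ {m} → Fin m → (Fin m → Carrier) → Fin m → Carrier
    restrict w f j = if does (j ≟ᶠ w) then f j else ε

    restrict-≡ : ∀ {m} (w : Fin m) (f : Fin m → Carrier) → restrict w f w ≈ f w
    restrict-≡ w f = ≈-reflexive (cong (if_then f w else ε) (dec-true (w ≟ᶠ w) refl))

    restrict-≢ : ∀ {m} {w j : Fin m} (f : Fin m → Carrier) → j ≢ w → restrict w f j ≈ ε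
    restrict-≢ {w = w} {j} f j≢w = ≈-reflexive (cong (if_then f j else ε) (dec-false (j ≟ᶠ w) j≢w))

    sum-restrict : ∀ {m} (w : Fin m) (f : Fin m → Carrier) → sum (restrict w f) ≈ f w
    sum-restrict w f = ≈-trans (sum-single w (λ j → restrict-≢ f)) (restrict-≡ w f)

  sum-triple : ∀ {m} {x y z : Fin m} {f : Fin m → Carrier} → x ≢ y → x ≢ z → y ≢ z →
               (∀ j → j ≢ x → j ≢ y → j ≢ z → f j ≈ ε) → sum f ≈ f x ∙ (f y ∙ f z)
  sum-triple {x = x} {y} {z} {f} x≢y x≢z y≢z vanish = begin
    sum f                                     ≈⟨ sum-cong-≋ split ⟩
    sum (λ j → fx j ∙ (fy j ∙ fz j))          ≈⟨ ∑-distrib-+ fx (λ j → fy j ∙ fz j) ⟩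
    sum fx ∙ sum (λ j → fy j ∙ fz j)          ≈⟨ ∙-congˡ (∑-distrib-+ fy fz) ⟩
    sum fx ∙ (sum fy ∙ sum fz)                ≈⟨ ∙-cong (sum-restrict x f) (∙-cong (sum-restrict y f) (sum-restrict z f)) ⟩
    f x ∙ (f y ∙ f z)                         ∎
    where
    fx fy fz : Fin _ → Carrier
    fx = restrict x f
    fy = restrict y f
    fz = restrict z f
    cases : ∀ j → Dec (j ≡ x) → Dec (j ≡ y) → Dec (j ≡ z) → f j ≈ fx j ∙ (fy j ∙ fz j)
    cases _ (yes refl) _ _ = ≈-sym (begin
      fx x ∙ (fy x ∙ fz x) ≈⟨ ∙-cong (restrict-≡ x f) (∙-cong (restrict-≢ f x≢y) (restrict-≢ f x≢z)) ⟩
      f x ∙ (ε ∙ ε)        ≈⟨ ∙-congˡ (identityˡ ε) ⟩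
      f x ∙ ε              ≈⟨ identityʳ (f x) ⟩
      f x                  ∎)
    cases _ (no j≢x) (yes refl) _ = ≈-sym (begin
      fx y ∙ (fy y ∙ fz y) ≈⟨ ∙-cong (restrict-≢ f j≢x) (∙-cong (restrict-≡ y f) (restrict-≢ f y≢z)) ⟩
      ε ∙ (f y ∙ ε)        ≈⟨ identityˡ _ ⟩
      f y ∙ ε              ≈⟨ identityʳ (f y) ⟩
      f y                  ∎)
    cases _ (no j≢x) (no j≢y) (yes refl) = ≈-sym (begin
      fx z ∙ (fy z ∙ fz z) ≈⟨ ∙-cong (restrict-≢ f j≢x) (∙-cong (restrict-≢ f j≢y) (restrict-≡ z f)) ⟩
      ε ∙ (ε ∙ f z)        ≈⟨ identityˡ _ ⟩
      ε ∙ f z              ≈⟨ identityˡ (f z) ⟩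
      f z                  ∎)
    cases j (no j≢x) (no j≢y) (no j≢z) = begin
      f j                  ≈⟨ vanish j j≢x j≢y j≢z ⟩
      ε                    ≈⟨ identityˡ ε ⟨
      ε ∙ ε                ≈⟨ identityˡ _ ⟨
      ε ∙ (ε ∙ ε)          ≈⟨ ∙-cong (restrict-≢ f j≢x) (∙-cong (restrict-≢ f j≢y) (restrict-≢ f j≢z)) ⟨
      fx j ∙ (fy j ∙ fz j) ∎
    split : ∀ j → f j ≈ fx j ∙ (fy j ∙ fz j)
    split j = cases j (j ≟ᶠ x) (j ≟ᶠ y) (j ≟ᶠ z)

open MonoidSum +-0-commutativeMonoid using (sum; sum-syntax; sum-cong-≗; ∑-distrib-+)
open TripleSum +-0-commutativeMonoid using (sum-zero; sum-single; sum-triple)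

module ∧-Sum = MonoidSum ∧-commutativeMonoid
module ∧-TripleSum = TripleSum ∧-commutativeMonoid
module ⊕-TripleSum = TripleSum (CommutativeRing.+-commutativeMonoid xor-∧-commutativeRing)

𝟙 : Bool → ℕ
𝟙 true  = 1
𝟙 false = 0

eqᵇ⇒≡ : ∀ {a b} → eqᵇ a b ≡ true → a ≡ b
eqᵇ⇒≡ {true}  {true}  _ = refl
eqᵇ⇒≡ {false} {false} _ = refl

≡⇒eqᵇ : ∀ {a b} → a ≡ b → eqᵇ a b ≡ true
≡⇒eqᵇ {true}  refl = refl
≡⇒eqᵇ {false} refl = refl

eqᵇ-falseʳ : ∀ a → eqᵇ a false ≡ not a
eqᵇ-falseʳ true  = refl
eqᵇ-falseʳ false = refl

eqᵇ≡false⇒xor : ∀ {a b} → eqᵇ a b ≡ false → a xor b ≡ true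
eqᵇ≡false⇒xor {true}  {false} _ = refl
eqᵇ≡false⇒xor {false} {true}  _ = refl

xor≡false⇒≡ : ∀ {a b} → a xor b ≡ false → a ≡ b
xor≡false⇒≡ {true}  {true}  _ = refl
xor≡false⇒≡ {false} {false} _ = refl

not-xor≡eqᵇ : ∀ a b c → not (a xor (b xor c)) ≡ eqᵇ c (a xor b)
not-xor≡eqᵇ true  true  true  = refl
not-xor≡eqᵇ true  true  false = refl
not-xor≡eqᵇ true  false true  = refl
not-xor≡eqᵇ true  false false = refl
not-xor≡eqᵇ false true  true  = refl
not-xor≡eqᵇ false true  false = refl
not-xor≡eqᵇ false false true  = refl
not-xor≡eqᵇ false false false = refl

∧-not-clash : ∀ a b c → a ∧ (b ∧ (c ∧ not a)) ≡ false
∧-not-clash false b c = refl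
∧-not-clash true  b c = trans (cong (b ∧_) (∧-zeroʳ c)) (∧-zeroʳ b)

≡xorʳ⇒false : ∀ {a b} → a ≡ a xor b → b ≡ false
≡xorʳ⇒false {true}  {false} _ = refl
≡xorʳ⇒false {false} {false} _ = refl

≡xorˡ⇒false : ∀ {a b} → b ≡ a xor b → a ≡ false
≡xorˡ⇒false {false} _ = refl
≡xorˡ⇒false {true} {true} ()
≡xorˡ⇒false {true} {false} ()

∧-implied : ∀ {a b} → (a ≡ true → b ≡ true) → a ∧ b ≡ a
∧-implied {true}  a⇒b = a⇒b refl
∧-implied {false} _   = refl

not-does⇒¬ : ∀ {a} {A : Set a} (a? : Dec A) → not (does a?) ≡ true → ¬ A
not-does⇒¬ (yes _) ()
not-does⇒¬ (no ¬a) _ = ¬a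

allᶠ⁺ : ∀ {m} {f : Fin m → Bool} → (∀ j → f j ≡ true) → allᶠ f ≡ true
allᶠ⁺ = ∧-TripleSum.sum-zero

allᶠ⁻ : ∀ {m} {f : Fin m → Bool} → allᶠ f ≡ true → ∀ j → f j ≡ true
allᶠ⁻ {suc m} {f} all j = ∧-conicalˡ _ _ (trans (sym (∧-Sum.sum-remove {i = j} f)) all)

allᶠ-false : ∀ {m} {f : Fin m → Bool} → allᶠ f ≡ false → ∃[ j ] f j ≡ false
allᶠ-false {suc m} {f} all with f zero in f₀
... | false = zero , f₀
... | true  with allᶠ-false {f = f ∘ suc} all
...   | j , fj = suc j , fj

∑𝟙≡suc⇒∃ : ∀ {m n} (f : Fin m → Bool) → ∑[ j < m ] 𝟙 (f j) ≡ suc n → ∃[ j ] f j ≡ true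
∑𝟙≡suc⇒∃ {suc m} f ∑≡ with f zero in f₀
... | true  = zero , f₀
... | false with ∑𝟙≡suc⇒∃ (f ∘ suc) ∑≡
...   | j , fj = suc j , fj

∑𝟙-point : ∀ {m} (x : Fin m) → ∑[ j < m ] 𝟙 (does (j ≟ᶠ x)) ≡ 1
∑𝟙-point x = trans (sum-single x (λ j j≢x → cong 𝟙 (dec-false (j ≟ᶠ x) j≢x)))
                   (cong 𝟙 (dec-true (x ≟ᶠ x) refl))

erase : ∀ {m} → Fin m → (Fin m → Bool) → Fin m → Bool
erase x f j = f j ∧ not (does (j ≟ᶠ x))

∑𝟙-erase : ∀ {m} {x : Fin m} (f : Fin m → Bool) → f x ≡ true →
           ∑[ j < m ] 𝟙 (f j) ≡ suc (∑[ j < m ] 𝟙 (erase x f j))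
∑𝟙-erase {m} {x} f fx = begin
  ∑[ j < m ] 𝟙 (f j)                                          ≡⟨ sum-cong-≗ split ⟩
  ∑[ j < m ] (δ j + 𝟙 (erase x f j))                          ≡⟨ ∑-distrib-+ δ (𝟙 ∘ erase x f) ⟩
  ∑[ j < m ] δ j + ∑[ j < m ] 𝟙 (erase x f j)                 ≡⟨ cong (_+ sum (𝟙 ∘ erase x f)) (∑𝟙-point x) ⟩
  suc (∑[ j < m ] 𝟙 (erase x f j))                            ∎
  where
  open ≡-Reasoning
  δ : Fin m → ℕ
  δ j = 𝟙 (does (j ≟ᶠ x))
  split : ∀ j → 𝟙 (f j) ≡ δ j + 𝟙 (erase x f j)
  split j with j ≟ᶠ x
  ... | yes refl rewrite fx = refl
  ... | no _     = cong 𝟙 (sym (∧-identityʳ (f j)))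

∣p∣≡∑𝟙 : ∀ {m} (p : Subset m) → ∣ p ∣ ≡ ∑[ j < m ] 𝟙 (lookup p j)
∣p∣≡∑𝟙 []            = refl
∣p∣≡∑𝟙 (inside ∷ p)  = cong suc (∣p∣≡∑𝟙 p)
∣p∣≡∑𝟙 (outside ∷ p) = ∣p∣≡∑𝟙 p

p⊆q⇒∣q∣≤∣p∣⇒p≡q : ∀ {m} {p q : Subset m} → p ⊆ q → ∣ q ∣ ≤ ∣ p ∣ → p ≡ q
p⊆q⇒∣q∣≤∣p∣⇒p≡q {p = []}          {[]}          _   _   = refl
p⊆q⇒∣q∣≤∣p∣⇒p≡q {p = outside ∷ p} {outside ∷ q} p⊆q q≤p =
  cong (outside ∷_) (p⊆q⇒∣q∣≤∣p∣⇒p≡q (drop-∷-⊆ p⊆q) q≤p)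
p⊆q⇒∣q∣≤∣p∣⇒p≡q {p = inside  ∷ p} {inside  ∷ q} p⊆q (s≤s q≤p) =
  cong (inside ∷_) (p⊆q⇒∣q∣≤∣p∣⇒p≡q (drop-∷-⊆ p⊆q) q≤p)
p⊆q⇒∣q∣≤∣p∣⇒p≡q {p = inside  ∷ p} {outside ∷ q} p⊆q _   with () ← p⊆q here
p⊆q⇒∣q∣≤∣p∣⇒p≡q {p = outside ∷ p} {inside  ∷ q} p⊆q q<p =
  contradiction (≤-trans q<p (p⊆q⇒∣p∣≤∣q∣ (drop-∷-⊆ p⊆q))) 1+n≰n

triple : ∀ {m} → Fin m → Fin m → Fin m → Subset m
triple x y z = tabulate (λ j → does (j ≟ᶠ x) ∨ (does (j ≟ᶠ y) ∨ does (j ≟ᶠ z)))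

triple-x : ∀ {m} (x y z : Fin m) → lookup (triple x y z) x ≡ true
triple-x x y z = trans (lookup∘tabulate _ x)
  (cong (_∨ (does (x ≟ᶠ y) ∨ does (x ≟ᶠ z))) (dec-true (x ≟ᶠ x) refl))

triple-y : ∀ {m} (x y z : Fin m) → lookup (triple x y z) y ≡ true
triple-y x y z = trans (lookup∘tabulate _ y)
  (trans (cong (λ b → does (y ≟ᶠ x) ∨ (b ∨ does (y ≟ᶠ z))) (dec-true (y ≟ᶠ y) refl)) (∨-zeroʳ _))

triple-z : ∀ {m} (x y z : Fin m) → lookup (triple x y z) z ≡ true
triple-z x y z = trans (lookup∘tabulate _ z)
  (trans (cong (λ b → does (z ≟ᶠ x) ∨ (does (z ≟ᶠ y) ∨ b)) (dec-true (z ≟ᶠ z) refl))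
    (trans (cong (does (z ≟ᶠ x) ∨_) (∨-zeroʳ _)) (∨-zeroʳ _)))

triple-∉ : ∀ {m} {x y z j : Fin m} → j ≢ x → j ≢ y → j ≢ z → lookup (triple x y z) j ≡ false
triple-∉ {x = x} {y} {z} {j} j≢x j≢y j≢z = trans (lookup∘tabulate _ j)
  (cong₂ _∨_ (dec-false (j ≟ᶠ x) j≢x) (cong₂ _∨_ (dec-false (j ≟ᶠ y) j≢y) (dec-false (j ≟ᶠ z) j≢z)))

triple⁻ : ∀ {m} (x y z : Fin m) {j} → lookup (triple x y z) j ≡ true → j ≡ x ⊎ j ≡ y ⊎ j ≡ z
triple⁻ x y z {j} j∈ with j ≟ᶠ x | j ≟ᶠ y | j ≟ᶠ z
... | yes j≡x | _       | _       = inj₁ j≡x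
... | no _    | yes j≡y | _       = inj₂ (inj₁ j≡y)
... | no _    | no _    | yes j≡z = inj₂ (inj₂ j≡z)
... | no j≢x  | no j≢y  | no j≢z  with () ← trans (sym j∈) (triple-∉ j≢x j≢y j≢z)

∣triple∣≡3 : ∀ {m} {x y z : Fin m} → x ≢ y → x ≢ z → y ≢ z → ∣ triple x y z ∣ ≡ 3
∣triple∣≡3 {x = x} {y} {z} x≢y x≢z y≢z = trans (∣p∣≡∑𝟙 (triple x y z))
  (trans (sum-triple x≢y x≢z y≢z (λ j j≢x j≢y j≢z → cong 𝟙 (triple-∉ j≢x j≢y j≢z)))
    (cong₂ _+_ (cong 𝟙 (triple-x x y z)) (cong₂ _+_ (cong 𝟙 (triple-y x y z)) (cong 𝟙 (triple-z x y z)))))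

triple-through : ∀ {m} {x y : Fin m} (B : Subset m) → x ≢ y → ∣ B ∣ ≡ 3 →
                 lookup B x ≡ true → lookup B y ≡ true → ∃[ z ] (x ≢ z × y ≢ z × B ≡ triple x y z)
triple-through {m} {x} {y} B x≢y ∣B∣≡3 Bx By =
  z , ≢-sym z≢x , ≢-sym z≢y
    , sym (p⊆q⇒∣q∣≤∣p∣⇒p≡q triple⊆B (≤-reflexive (trans ∣B∣≡3 (sym ∣xyz∣≡3))))
  where
  B∖x : Fin m → Bool
  B∖x = erase x (lookup B)
  B∖x∋y : B∖x y ≡ true
  B∖x∋y = cong₂ _∧_ By (cong not (dec-false (y ≟ᶠ x) (≢-sym x≢y)))
  one-left : ∑[ j < m ] 𝟙 (erase y B∖x j) ≡ 1
  one-left = suc-injective (suc-injective (sym (begin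
    3                                    ≡⟨ sym ∣B∣≡3 ⟩
    ∣ B ∣                                ≡⟨ ∣p∣≡∑𝟙 B ⟩
    ∑[ j < m ] 𝟙 (lookup B j)            ≡⟨ ∑𝟙-erase (lookup B) Bx ⟩
    suc (∑[ j < m ] 𝟙 (B∖x j))           ≡⟨ cong suc (∑𝟙-erase B∖x B∖x∋y) ⟩
    suc (suc (∑[ j < m ] 𝟙 (erase y B∖x j))) ∎)))
    where open ≡-Reasoning
  z : Fin m
  z = proj₁ (∑𝟙≡suc⇒∃ (erase y B∖x) one-left)
  Bz∖x∖y : erase y B∖x z ≡ true
  Bz∖x∖y = proj₂ (∑𝟙≡suc⇒∃ (erase y B∖x) one-left)
  Bz∖x : B∖x z ≡ true
  Bz∖x = ∧-conicalˡ _ _ Bz∖x∖y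
  Bz : lookup B z ≡ true
  Bz = ∧-conicalˡ _ _ Bz∖x
  z≢x : z ≢ x
  z≢x = not-does⇒¬ (z ≟ᶠ x) (∧-conicalʳ _ _ Bz∖x)
  z≢y : z ≢ y
  z≢y = not-does⇒¬ (z ≟ᶠ y) (∧-conicalʳ _ _ Bz∖x∖y)
  ∣xyz∣≡3 : ∣ triple x y z ∣ ≡ 3
  ∣xyz∣≡3 = ∣triple∣≡3 x≢y (≢-sym z≢x) (≢-sym z≢y)
  triple⊆B : triple x y z ⊆ B
  triple⊆B {j} j∈ with triple⁻ x y z ([]=⇒lookup j∈)
  ... | inj₁ refl        = lookup⇒[]= j B Bx
  ... | inj₂ (inj₁ refl) = lookup⇒[]= j B By
  ... | inj₂ (inj₂ refl) = lookup⇒[]= j B Bz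

∑ᵛ : ∀ {m} → (Vec Bool m → ℕ) → ℕ
∑ᵛ {zero}  g = g []
∑ᵛ {suc m} g = ∑ᵛ (g ∘ (false ∷_)) + ∑ᵛ (g ∘ (true ∷_))

∑ᵛ-cong : ∀ {m} {g h : Vec Bool m → ℕ} → (∀ v → g v ≡ h v) → ∑ᵛ g ≡ ∑ᵛ h
∑ᵛ-cong {zero}  g≡h = g≡h []
∑ᵛ-cong {suc m} g≡h = cong₂ _+_ (∑ᵛ-cong (g≡h ∘ (false ∷_))) (∑ᵛ-cong (g≡h ∘ (true ∷_)))

∑ᵛ-zero : ∀ {m} {g : Vec Bool m → ℕ} → (∀ v → g v ≡ 0) → ∑ᵛ g ≡ 0
∑ᵛ-zero {zero}  g≡0 = g≡0 []
∑ᵛ-zero {suc m} g≡0 = cong₂ _+_ (∑ᵛ-zero (g≡0 ∘ (false ∷_))) (∑ᵛ-zero (g≡0 ∘ (true ∷_)))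

∑ᵛ-single : ∀ {m} {g : Vec Bool m → ℕ} (c : Vec Bool m) → (∀ v → v ≢ c → g v ≡ 0) → ∑ᵛ g ≡ g c
∑ᵛ-single []          _      = refl
∑ᵛ-single (false ∷ c) vanish = trans
  (cong₂ _+_ (∑ᵛ-single c (λ v v≢c → vanish (false ∷ v) (v≢c ∘ ∷-injectiveʳ)))
             (∑ᵛ-zero (λ v → vanish (true ∷ v) λ ())))
  (+-identityʳ _)
∑ᵛ-single (true ∷ c)  vanish =
  cong₂ _+_ (∑ᵛ-zero (λ v → vanish (false ∷ v) λ ()))
            (∑ᵛ-single c (λ v v≢c → vanish (true ∷ v) (v≢c ∘ ∷-injectiveʳ)))

∑ᵛ-∑-comm : ∀ {m k} (g : Vec Bool m → Fin k → ℕ) →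
            ∑ᵛ (λ v → ∑[ z < k ] g v z) ≡ ∑[ z < k ] ∑ᵛ (λ v → g v z)
∑ᵛ-∑-comm {zero}  g = refl
∑ᵛ-∑-comm {suc m} g = trans
  (cong₂ _+_ (∑ᵛ-∑-comm (g ∘ (false ∷_))) (∑ᵛ-∑-comm (g ∘ (true ∷_))))
  (sym (∑-distrib-+ (λ z → ∑ᵛ (λ v → g (false ∷ v) z)) (λ z → ∑ᵛ (λ v → g (true ∷ v) z))))

length-filterᵇ-map : ∀ {A B : Set} (p : B → Bool) (f : A → B) (xs : List A) →
                     length (filterᵇ p (map f xs)) ≡ length (filterᵇ (p ∘ f) xs)
length-filterᵇ-map p f []ₗ        = refl
length-filterᵇ-map p f (x ∷ₗ xs) with p (f x)
... | true  = cong suc (length-filterᵇ-map p f xs)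
... | false = length-filterᵇ-map p f xs

countSubsets≡∑ᵛ : ∀ {m} (p : Subset m → Bool) → countSubsets p ≡ ∑ᵛ (𝟙 ∘ p)
countSubsets≡∑ᵛ {zero} p with p []
... | true  = refl
... | false = refl
countSubsets≡∑ᵛ {suc m} p = begin
  length (filterᵇ p (map (true ∷_) S ++ map (false ∷_) S))
    ≡⟨ cong length (filter-++ (T? ∘ p) (map (true ∷_) S) (map (false ∷_) S)) ⟩
  length (filterᵇ p (map (true ∷_) S) ++ filterᵇ p (map (false ∷_) S))
    ≡⟨ length-++ (filterᵇ p (map (true ∷_) S)) ⟩
  length (filterᵇ p (map (true ∷_) S)) + length (filterᵇ p (map (false ∷_) S))
    ≡⟨ cong₂ _+_ (length-filterᵇ-map p (true ∷_) S) (length-filterᵇ-map p (false ∷_) S) ⟩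
  countSubsets (p ∘ (true ∷_)) + countSubsets (p ∘ (false ∷_))
    ≡⟨ cong₂ _+_ (countSubsets≡∑ᵛ (p ∘ (true ∷_))) (countSubsets≡∑ᵛ (p ∘ (false ∷_))) ⟩
  ∑ᵛ (𝟙 ∘ p ∘ (true ∷_)) + ∑ᵛ (𝟙 ∘ p ∘ (false ∷_))
    ≡⟨ +-comm (∑ᵛ (𝟙 ∘ p ∘ (true ∷_))) _ ⟩
  ∑ᵛ (𝟙 ∘ p)
    ∎
  where
  open ≡-Reasoning
  S : List (Subset m)
  S = allSubsets m

countSubsets-cong : ∀ {m} {p q : Subset m → Bool} → (∀ B → p B ≡ q B) → countSubsets p ≡ countSubsets q
countSubsets-cong {p = p} {q} p≡q =
  trans (countSubsets≡∑ᵛ p) (trans (∑ᵛ-cong (cong 𝟙 ∘ p≡q)) (sym (countSubsets≡∑ᵛ q)))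

_≟ˢ_ : ∀ {m} (B C : Subset m) → Dec (B ≡ C)
_≟ˢ_ = ≡-dec _≟ᵇ_

module _ {m} {x y : Fin m} (x≢y : x ≢ y)
         (q : Subset m → Bool) (q⇒3 : ∀ B → q B ≡ true → ∣ B ∣ ≡ 3) where

  private
    through : Subset m → Bool
    through B = q B ∧ (lookup B x ∧ lookup B y)

    through-triple : ∀ z → through (triple x y z) ≡ q (triple x y z)
    through-triple z = trans (cong (q (triple x y z) ∧_) (cong₂ _∧_ (triple-x x y z) (triple-y x y z)))
                             (∧-identityʳ _)

    through⇒triple : ∀ B → through B ≡ true → ∃[ z ] (x ≢ z × y ≢ z × B ≡ triple x y z)
    through⇒triple B tB = triple-through B x≢y (q⇒3 B (∧-conicalˡ (q B) _ tB))
                                         (∧-conicalˡ (lookup B x) _ x,y∈B) (∧-conicalʳ (lookup B x) _ x,y∈B)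
      where
      x,y∈B : lookup B x ∧ lookup B y ≡ true
      x,y∈B = ∧-conicalʳ (q B) _ tB

  -- A counted set is triple x y z for exactly one third point z ∉ {x, y}; f selects the admissible z.
  count-triples-through : (f : Fin m → Bool) → f x ≡ false → f y ≡ false →
                          (∀ z → x ≢ z → y ≢ z → q (triple x y z) ≡ f z) →
                          countSubsets through ≡ ∑[ z < m ] 𝟙 (f z)
  count-triples-through f fx fy q≡f = begin
    countSubsets through                 ≡⟨ countSubsets≡∑ᵛ through ⟩
    ∑ᵛ (𝟙 ∘ through)                     ≡⟨ ∑ᵛ-cong split ⟩
    ∑ᵛ (λ B → ∑[ z < m ] term B z)       ≡⟨ ∑ᵛ-∑-comm term ⟩
    ∑[ z < m ] ∑ᵛ (λ B → term B z)       ≡⟨ sum-cong-≗ (λ z → ∑ᵛ-single (triple x y z) (λ B → term-≢ {B})) ⟩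
    ∑[ z < m ] term (triple x y z) z     ≡⟨ sum-cong-≗ term-≡ ⟩
    ∑[ z < m ] 𝟙 (f z)                   ∎
    where
    open ≡-Reasoning
    term : Subset m → Fin m → ℕ
    term B z = 𝟙 (does (B ≟ˢ triple x y z) ∧ f z)

    term-≢ : ∀ {B z} → B ≢ triple x y z → term B z ≡ 0
    term-≢ {B} {z} B≢ = cong (λ b → 𝟙 (b ∧ f z)) (dec-false (B ≟ˢ triple x y z) B≢)

    term-≡ : ∀ z → term (triple x y z) z ≡ 𝟙 (f z)
    term-≡ z = cong (λ b → 𝟙 (b ∧ f z)) (dec-true (triple x y z ≟ˢ triple x y z) refl)

    f-off : ∀ z → through (triple x y z) ≡ false → f z ≡ false
    f-off z off with x ≟ᶠ z | y ≟ᶠ z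
    ... | yes refl | _        = fx
    ... | no _     | yes refl = fy
    ... | no x≢z   | no y≢z   = trans (sym (q≡f z x≢z y≢z)) (trans (sym (through-triple z)) off)

    split : ∀ B → 𝟙 (through B) ≡ ∑[ z < m ] term B z
    split B with through B in tB
    ... | false = sym (sum-zero never)
      where
      never : ∀ z → term B z ≡ 0
      never z with B ≟ˢ triple x y z
      ... | no _     = refl
      ... | yes refl = cong 𝟙 (f-off z tB)
    ... | true with through⇒triple B tB
    ...   | z₀ , x≢z₀ , y≢z₀ , refl =
      sym (trans (sum-single z₀ (λ z z≢z₀ → term-≢ (other z z≢z₀))) counted)
      where
      counted : term (triple x y z₀) z₀ ≡ 1
      counted = trans (term-≡ z₀)
                      (cong 𝟙 (trans (sym (q≡f z₀ x≢z₀ y≢z₀)) (trans (sym (through-triple z₀)) tB)))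
      other : ∀ z → z ≢ z₀ → triple x y z₀ ≢ triple x y z
      other z z≢z₀ eq with () ← trans (sym (triple-z x y z₀))
        (trans (cong (λ C → lookup C z₀) eq) (triple-∉ (≢-sym x≢z₀) (≢-sym y≢z₀) (≢-sym z≢z₀)))

triple-of : ∀ {m} (B : Subset m) → ∣ B ∣ ≡ 3 →
            ∃[ a ] ∃[ b ] (a ≢ b × ∃[ c ] (a ≢ c × b ≢ c × B ≡ triple a b c))
triple-of {m} B ∣B∣≡3 = a , b , a≢b , triple-through B a≢b ∣B∣≡3 Ba Bb
  where
  first : ∃[ a ] lookup B a ≡ true
  first = ∑𝟙≡suc⇒∃ (lookup B) (trans (sym (∣p∣≡∑𝟙 B)) ∣B∣≡3)
  a : Fin m
  a = proj₁ first
  Ba : lookup B a ≡ true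
  Ba = proj₂ first
  second : ∃[ b ] erase a (lookup B) b ≡ true
  second = ∑𝟙≡suc⇒∃ (erase a (lookup B))
             (suc-injective (trans (sym (∑𝟙-erase (lookup B) Ba)) (trans (sym (∣p∣≡∑𝟙 B)) ∣B∣≡3)))
  b : Fin m
  b = proj₁ second
  Bb : lookup B b ≡ true
  Bb = ∧-conicalˡ (lookup B b) _ (proj₂ second)
  a≢b : a ≢ b
  a≢b = ≢-sym (not-does⇒¬ (b ≟ᶠ a) (∧-conicalʳ (lookup B b) _ (proj₂ second)))

_⊕_ : ∀ {k} → (Fin k → Bool) → (Fin k → Bool) → Fin k → Bool
(u ⊕ v) i = u i xor v i

𝟎 : ∀ {k} → Fin k → Bool
𝟎 _ = false

-- The notions of Setup for an arbitrary parity-check matrix H; Setup n t κ is ParityCheck Hnt.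
module ParityCheck {k m : ℕ} (H : Fin k → Fin m → Bool) where

  isCodeword : (Fin m → Bool) → Bool
  isCodeword c = allᶠ (λ i → not (parity (λ j → H i j ∧ c j)))

  isBlock : Subset m → Bool
  isBlock B = (∣ B ∣ ≡ᵇ 3) ∧ isCodeword (lookup B)

  V0 : Subset m
  V0 = tabulate (λ j → allᶠ (λ i → not (H i j)))

  hasColumn : Fin m → (Fin k → Bool) → Bool
  hasColumn j u = allᶠ (λ i → eqᵇ (H i j) (u i))

  group : (Fin k → Bool) → Subset m
  group u = tabulate (λ j → hasColumn j u)

  sameGroup : Fin m → Fin m → Bool
  sameGroup x y = not (lookup V0 x) ∧ allᶠ (λ i → eqᵇ (H i x) (H i y))

  disjointV0 : Subset m → Bool
  disjointV0 B = allᶠ (λ j → not (lookup B j ∧ lookup V0 j))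

  insideV0 : Subset m → Bool
  insideV0 B = allᶠ (λ j → not (lookup B j) ∨ lookup V0 j)

  otherBlock : Subset m → Bool
  otherBlock B = isBlock B ∧ not (insideV0 B) ∧ not (disjointV0 B)

  column : Fin m → Fin k → Bool
  column j i = H i j

  hasColumn⁺ : ∀ {j u} → column j ≗ u → hasColumn j u ≡ true
  hasColumn⁺ col≗u = allᶠ⁺ (≡⇒eqᵇ ∘ col≗u)

  hasColumn⁻ : ∀ {j u} → hasColumn j u ≡ true → column j ≗ u
  hasColumn⁻ has = eqᵇ⇒≡ ∘ allᶠ⁻ has

  hasColumn-cong : ∀ j {u v} → u ≗ v → hasColumn j u ≡ hasColumn j v
  hasColumn-cong j u≗v = ∧-Sum.sum-cong-≗ (cong (eqᵇ (H _ j)) ∘ u≗v)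

  lookup-group : ∀ u j → lookup (group u) j ≡ hasColumn j u
  lookup-group u = lookup∘tabulate (λ j → hasColumn j u)

  V0≡group𝟎 : V0 ≡ group 𝟎
  V0≡group𝟎 = tabulate-cong (λ j → ∧-Sum.sum-cong-≗ (λ i → sym (eqᵇ-falseʳ (H i j))))

  lookup-V0 : ∀ j → lookup V0 j ≡ hasColumn j 𝟎
  lookup-V0 j = trans (cong (λ C → lookup C j) V0≡group𝟎) (lookup-group 𝟎 j)

  V0⁺ : ∀ {j} → column j ≗ 𝟎 → lookup V0 j ≡ true
  V0⁺ col≗𝟎 = trans (lookup-V0 _) (hasColumn⁺ col≗𝟎)

  V0⁻ : ∀ {j} → lookup V0 j ≡ true → column j ≗ 𝟎
  V0⁻ j∈V0 = hasColumn⁻ (trans (sym (lookup-V0 _)) j∈V0)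

  ∉V0⇒nonzero : ∀ {j} → lookup V0 j ≡ false → ¬ (column j ≗ 𝟎)
  ∉V0⇒nonzero j∉V0 j≗𝟎 = contradiction (trans (sym (V0⁺ j≗𝟎)) j∉V0) λ ()

  sameGroup⁺ : ∀ {x y} → lookup V0 x ≡ false → column x ≗ column y → sameGroup x y ≡ true
  sameGroup⁺ x∉V0 x≗y = cong₂ _∧_ (cong not x∉V0) (hasColumn⁺ x≗y)

  sameGroup⁻ : ∀ {x y} → sameGroup x y ≡ true → lookup V0 x ≡ false × column x ≗ column y
  sameGroup⁻ {x} same = not-injective (∧-conicalˡ (not (lookup V0 x)) _ same)
                      , hasColumn⁻ (∧-conicalʳ (not (lookup V0 x)) _ same)

  module _ {x y z : Fin m} (x≢y : x ≢ y) (x≢z : x ≢ z) (y≢z : y ≢ z) where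

    private
      S : Subset m
      S = triple x y z

      at-members : ∀ {A : Set} (_∙_ : A → A → A) (φ : Bool → Fin m → A) →
                   φ (lookup S x) x ∙ (φ (lookup S y) y ∙ φ (lookup S z) z)
                   ≡ φ true x ∙ (φ true y ∙ φ true z)
      at-members _∙_ φ = cong₂ _∙_ (cong (λ b → φ b x) (triple-x x y z))
                           (cong₂ _∙_ (cong (λ b → φ b y) (triple-y x y z)) (cong (λ b → φ b z) (triple-z x y z)))

    syndrome-triple : ∀ i → parity (λ j → H i j ∧ lookup S j) ≡ H i x xor (H i y xor H i z)
    syndrome-triple i = begin
      parity (λ j → H i j ∧ lookup S j)
        ≡⟨ ⊕-TripleSum.sum-triple x≢y x≢z y≢z off-S ⟩
      (H i x ∧ lookup S x) xor ((H i y ∧ lookup S y) xor (H i z ∧ lookup S z))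
        ≡⟨ at-members _xor_ (λ b j → H i j ∧ b) ⟩
      (H i x ∧ true) xor ((H i y ∧ true) xor (H i z ∧ true))
        ≡⟨ cong₂ _xor_ (∧-identityʳ (H i x)) (cong₂ _xor_ (∧-identityʳ (H i y)) (∧-identityʳ (H i z))) ⟩
      H i x xor (H i y xor H i z)
        ∎
      where
      open ≡-Reasoning
      off-S : ∀ j → j ≢ x → j ≢ y → j ≢ z → H i j ∧ lookup S j ≡ false
      off-S j j≢x j≢y j≢z = trans (cong (H i j ∧_) (triple-∉ j≢x j≢y j≢z)) (∧-zeroʳ (H i j))

    isCodeword-triple : isCodeword (lookup S) ≡ hasColumn z (column x ⊕ column y)
    isCodeword-triple = ∧-Sum.sum-cong-≗ (λ i →
      trans (cong not (syndrome-triple i)) (not-xor≡eqᵇ (H i x) (H i y) (H i z)))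

    isBlock-triple : isBlock S ≡ hasColumn z (column x ⊕ column y)
    isBlock-triple = cong₂ _∧_ (cong (_≡ᵇ 3) (∣triple∣≡3 x≢y x≢z y≢z)) isCodeword-triple

    disjointV0-triple : disjointV0 S ≡ not (lookup V0 x) ∧ (not (lookup V0 y) ∧ not (lookup V0 z))
    disjointV0-triple = trans
      (∧-TripleSum.sum-triple x≢y x≢z y≢z
         (λ j j≢x j≢y j≢z → cong (λ b → not (b ∧ lookup V0 j)) (triple-∉ j≢x j≢y j≢z)))
      (at-members _∧_ (λ b j → not (b ∧ lookup V0 j)))

    insideV0-triple : insideV0 S ≡ lookup V0 x ∧ (lookup V0 y ∧ lookup V0 z)
    insideV0-triple = trans
      (∧-TripleSum.sum-triple x≢y x≢z y≢z
         (λ j j≢x j≢y j≢z → cong (λ b → not b ∨ lookup V0 j) (triple-∉ j≢x j≢y j≢z)))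
      (at-members _∧_ (λ b j → not b ∨ lookup V0 j))

    ∣triple∩V0∣ : ∣ S ∩ V0 ∣ ≡ 𝟙 (lookup V0 x) + (𝟙 (lookup V0 y) + 𝟙 (lookup V0 z))
    ∣triple∩V0∣ = begin
      ∣ S ∩ V0 ∣
        ≡⟨ ∣p∣≡∑𝟙 (S ∩ V0) ⟩
      ∑[ j < m ] 𝟙 (lookup (S ∩ V0) j)
        ≡⟨ sum-cong-≗ (λ j → cong 𝟙 (lookup-zipWith _∧_ j S V0)) ⟩
      ∑[ j < m ] 𝟙 (lookup S j ∧ lookup V0 j)
        ≡⟨ sum-triple x≢y x≢z y≢z (λ j j≢x j≢y j≢z → cong (λ b → 𝟙 (b ∧ lookup V0 j)) (triple-∉ j≢x j≢y j≢z)) ⟩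
      𝟙 (lookup S x ∧ lookup V0 x) + (𝟙 (lookup S y ∧ lookup V0 y) + 𝟙 (lookup S z ∧ lookup V0 z))
        ≡⟨ at-members _+_ (λ b j → 𝟙 (b ∧ lookup V0 j)) ⟩
      𝟙 (lookup V0 x) + (𝟙 (lookup V0 y) + 𝟙 (lookup V0 z))
        ∎
      where open ≡-Reasoning

  isBlock⇒∣∣≡3 : ∀ {B} → isBlock B ≡ true → ∣ B ∣ ≡ 3
  isBlock⇒∣∣≡3 {B} block =
    ≡ᵇ⇒≡ ∣ B ∣ 3 (Equivalence.from T⇔≡true (∧-conicalˡ (∣ B ∣ ≡ᵇ 3) _ block))

  ∣group∣≡∑ : ∀ u → ∣ group u ∣ ≡ ∑[ j < m ] 𝟙 (hasColumn j u)
  ∣group∣≡∑ u = trans (∣p∣≡∑𝟙 (group u)) (sum-cong-≗ (cong 𝟙 ∘ lookup-group u))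

  ⊆V0⇒isCodeword : ∀ {B} → B ⊆ V0 → isCodeword (lookup B) ≡ true
  ⊆V0⇒isCodeword {B} B⊆V0 = allᶠ⁺ (λ i → cong not (⊕-TripleSum.sum-zero (vanish i)))
    where
    vanish : ∀ i j → H i j ∧ lookup B j ≡ false
    vanish i j with lookup B j in j∈B
    ... | false = ∧-zeroʳ (H i j)
    ... | true  = cong (_∧ true) (V0⁻ ([]=⇒lookup (B⊆V0 (lookup⇒[]= j B j∈B))) i)

  blocks-inside-V0 : ∀ B → ∣ B ∣ ≡ 3 → B ⊆ V0 → isBlock B ≡ true
  blocks-inside-V0 B ∣B∣≡3 B⊆V0 = cong₂ _∧_ (cong (_≡ᵇ 3) ∣B∣≡3) (⊆V0⇒isCodeword B⊆V0)

  sameGroup⇒⊕≗𝟎 : ∀ {x y} → sameGroup x y ≡ true → column x ⊕ column y ≗ 𝟎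
  sameGroup⇒⊕≗𝟎 {y = y} same i = trans (cong (_xor H i y) (proj₂ (sameGroup⁻ same) i)) (xor-same (H i y))

  count-disjoint-blocks-through : ∀ {x y} → x ≢ y → (f : Fin m → Bool) → f x ≡ false → f y ≡ false →
    (∀ z → x ≢ z → y ≢ z → isBlock (triple x y z) ∧ disjointV0 (triple x y z) ≡ f z) →
    countSubsets (λ B → isBlock B ∧ disjointV0 B ∧ lookup B x ∧ lookup B y) ≡ ∑[ z < m ] 𝟙 (f z)
  count-disjoint-blocks-through x≢y f fx fy on-triple = trans
    (countSubsets-cong (λ B → sym (∧-assoc (isBlock B) (disjointV0 B) _)))
    (count-triples-through x≢y (λ B → isBlock B ∧ disjointV0 B)
                           (λ B → isBlock⇒∣∣≡3 {B} ∘ ∧-conicalˡ (isBlock B) (disjointV0 B)) f fx fy on-triple)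

  disjoint-blocks-within-group : ∀ {x y} → x ≢ y → sameGroup x y ≡ true →
    countSubsets (λ B → isBlock B ∧ disjointV0 B ∧ lookup B x ∧ lookup B y) ≡ 0
  disjoint-blocks-within-group {x} {y} x≢y same =
    trans (count-disjoint-blocks-through x≢y 𝟎 refl refl none) (sum-zero {m} {f = λ _ → 0} (λ _ → refl))
    where
    none : ∀ z → x ≢ z → y ≢ z → isBlock (triple x y z) ∧ disjointV0 (triple x y z) ≡ false
    none z x≢z y≢z = begin
      isBlock (triple x y z) ∧ disjointV0 (triple x y z)
        ≡⟨ cong₂ _∧_ (isBlock-triple x≢y x≢z y≢z) (disjointV0-triple x≢y x≢z y≢z) ⟩
      hasColumn z (column x ⊕ column y) ∧ (not (lookup V0 x) ∧ (not (lookup V0 y) ∧ not (lookup V0 z)))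
        ≡⟨ cong (_∧ (not (lookup V0 x) ∧ (not (lookup V0 y) ∧ not (lookup V0 z))))
                (trans (hasColumn-cong z (sameGroup⇒⊕≗𝟎 same)) (sym (lookup-V0 z))) ⟩
      lookup V0 z ∧ (not (lookup V0 x) ∧ (not (lookup V0 y) ∧ not (lookup V0 z)))
        ≡⟨ ∧-not-clash (lookup V0 z) (not (lookup V0 x)) (not (lookup V0 y)) ⟩
      false
        ∎
      where open ≡-Reasoning

  sameGroup≡false⇒⊕≢𝟎 : ∀ {x y} → lookup V0 x ≡ false → sameGroup x y ≡ false →
                         ∃[ i ] (column x ⊕ column y) i ≡ true
  sameGroup≡false⇒⊕≢𝟎 {x} {y} x∉V0 different
    with allᶠ-false (trans (cong (λ b → not b ∧ hasColumn x (column y)) (sym x∉V0)) different)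
  ... | i , differ = i , eqᵇ≡false⇒xor differ

  hasNonzeroColumn⇒∉V0 : ∀ {z u} {i} → u i ≡ true → hasColumn z u ≡ true → lookup V0 z ≡ false
  hasNonzeroColumn⇒∉V0 {z} {u} {i} ui has = ¬-not λ z∈V0 →
    contradiction (trans (sym ui) (trans (sym (hasColumn⁻ has i)) (V0⁻ z∈V0 i))) λ ()

  disjoint-blocks-across-groups : ∀ {x y} →
    lookup V0 x ≡ false → lookup V0 y ≡ false → sameGroup x y ≡ false →
    countSubsets (λ B → isBlock B ∧ disjointV0 B ∧ lookup B x ∧ lookup B y)
    ≡ ∣ group (column x ⊕ column y) ∣
  disjoint-blocks-across-groups {x} {y} x∉V0 y∉V0 different =
    trans (count-disjoint-blocks-through x≢y (λ z → hasColumn z u) ux uy on-triple) (sym (∣group∣≡∑ u))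
    where
    u : Fin k → Bool
    u = column x ⊕ column y
    nonzero : ∃[ i ] u i ≡ true
    nonzero = sameGroup≡false⇒⊕≢𝟎 x∉V0 different
    x≢y : x ≢ y
    x≢y refl = contradiction (trans (sym (proj₂ nonzero)) (xor-same (H (proj₁ nonzero) x))) λ ()
    ux : hasColumn x u ≡ false
    ux = ¬-not λ has → ∉V0⇒nonzero y∉V0 (≡xorʳ⇒false ∘ hasColumn⁻ has)
    uy : hasColumn y u ≡ false
    uy = ¬-not λ has → ∉V0⇒nonzero x∉V0 (≡xorˡ⇒false ∘ hasColumn⁻ has)
    on-triple : ∀ z → x ≢ z → y ≢ z → isBlock (triple x y z) ∧ disjointV0 (triple x y z) ≡ hasColumn z u
    on-triple z x≢z y≢z = begin
      isBlock (triple x y z) ∧ disjointV0 (triple x y z)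
        ≡⟨ cong₂ _∧_ (isBlock-triple x≢y x≢z y≢z) (disjointV0-triple x≢y x≢z y≢z) ⟩
      hasColumn z u ∧ (not (lookup V0 x) ∧ (not (lookup V0 y) ∧ not (lookup V0 z)))
        ≡⟨ cong₂ (λ a b → hasColumn z u ∧ (not a ∧ (not b ∧ not (lookup V0 z)))) x∉V0 y∉V0 ⟩
      hasColumn z u ∧ not (lookup V0 z)
        ≡⟨ ∧-implied (cong not ∘ hasNonzeroColumn⇒∉V0 (proj₂ nonzero)) ⟩
      hasColumn z u
        ∎
      where open ≡-Reasoning

  other-blocks-within-group : ∀ {x y} → x ≢ y → sameGroup x y ≡ true →
    countSubsets (λ B → otherBlock B ∧ lookup B x ∧ lookup B y) ≡ ∣ V0 ∣
  other-blocks-within-group {x} {y} x≢y same =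
    trans (count-triples-through x≢y otherBlock (λ B → isBlock⇒∣∣≡3 {B} ∘ ∧-conicalˡ (isBlock B) _)
                                 (λ z → lookup V0 z) x∉V0 y∉V0 on-triple)
          (sym (∣p∣≡∑𝟙 V0))
    where
    x∉V0 : lookup V0 x ≡ false
    x∉V0 = proj₁ (sameGroup⁻ same)
    x≗y : column x ≗ column y
    x≗y = proj₂ (sameGroup⁻ same)
    y∉V0 : lookup V0 y ≡ false
    y∉V0 = ¬-not λ y∈V0 → ∉V0⇒nonzero x∉V0 (λ i → trans (x≗y i) (V0⁻ y∈V0 i))
    on-triple : ∀ z → x ≢ z → y ≢ z → otherBlock (triple x y z) ≡ lookup V0 z
    on-triple z x≢z y≢z = begin
      otherBlock (triple x y z)
        ≡⟨ cong₂ _∧_ (isBlock-triple x≢y x≢z y≢z) (cong₂ _∧_ (cong not (insideV0-triple x≢y x≢z y≢z))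
                                                           (cong not (disjointV0-triple x≢y x≢z y≢z))) ⟩
      isSum ∧ (not (lookup V0 x ∧ (lookup V0 y ∧ Vz)) ∧ not (not (lookup V0 x) ∧ (not (lookup V0 y) ∧ not Vz)))
        ≡⟨ cong₂ (λ a b → isSum ∧ (not (a ∧ (b ∧ Vz)) ∧ not (not a ∧ (not b ∧ not Vz)))) x∉V0 y∉V0 ⟩
      isSum ∧ not (not Vz)
        ≡⟨ cong₂ _∧_ (trans (hasColumn-cong z (sameGroup⇒⊕≗𝟎 same)) (sym (lookup-V0 z))) (not-involutive Vz) ⟩
      Vz ∧ Vz
        ≡⟨ ∧-idem Vz ⟩
      Vz
        ∎
      where
      open ≡-Reasoning
      Vz isSum : Bool
      Vz = lookup V0 z
      isSum = hasColumn z (column x ⊕ column y)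

  HasSameGroupPair : Subset m → Set
  HasSameGroupPair B = ∃[ x ] ∃[ y ] (x ≢ y × x ∈ B × y ∈ B × sameGroup x y ≡ true)

  module _ {a b c : Fin m} (c≗a⊕b : column c ≗ column a ⊕ column b) where

    private
      a∈V0⇒b≗c : lookup V0 a ≡ true → column b ≗ column c
      a∈V0⇒b≗c a∈V0 i = sym (trans (c≗a⊕b i) (cong (_xor H i b) (V0⁻ a∈V0 i)))

      b∈V0⇒a≗c : lookup V0 b ≡ true → column a ≗ column c
      b∈V0⇒a≗c b∈V0 i =
        sym (trans (c≗a⊕b i) (trans (cong (H i a xor_) (V0⁻ b∈V0 i)) (xor-identityʳ (H i a))))

      c∈V0⇒a≗b : lookup V0 c ≡ true → column a ≗ column b
      c∈V0⇒a≗b c∈V0 i = xor≡false⇒≡ (trans (sym (c≗a⊕b i)) (V0⁻ c∈V0 i))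

      member : ∀ j → lookup (triple a b c) j ≡ true → j ∈ triple a b c
      member j = lookup⇒[]= j (triple a b c)

    -- As column c = column a ⊕ column b, two points in V0 would force the third into V0,
    -- while a single point in V0 makes the columns of the other two equal.
    triple-meets-V0-once : a ≢ b → a ≢ c → b ≢ c →
      lookup V0 a ∧ (lookup V0 b ∧ lookup V0 c) ≡ false →
      not (lookup V0 a) ∧ (not (lookup V0 b) ∧ not (lookup V0 c)) ≡ false →
      ∣ triple a b c ∩ V0 ∣ ≡ 1 × HasSameGroupPair (triple a b c)
    triple-meets-V0-once a≢b a≢c b≢c notAll notNone =
      trans (∣triple∩V0∣ a≢b a≢c b≢c) (proj₁ shape) , proj₂ shape
      where
      cases : ∀ α β γ → lookup V0 a ≡ α → lookup V0 b ≡ β → lookup V0 c ≡ γ →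
              α ∧ (β ∧ γ) ≡ false → not α ∧ (not β ∧ not γ) ≡ false →
              𝟙 α + (𝟙 β + 𝟙 γ) ≡ 1 × HasSameGroupPair (triple a b c)
      cases true  true  true  _  _  _  ()  _
      cases false false false _  _  _  _   ()
      cases true  true  false va vb vc _ _ =
        contradiction (λ i → trans (sym (b∈V0⇒a≗c vb i)) (V0⁻ va i)) (∉V0⇒nonzero vc)
      cases true  false true  va vb vc _ _ =
        contradiction (λ i → trans (a∈V0⇒b≗c va i) (V0⁻ vc i)) (∉V0⇒nonzero vb)
      cases false true  true  va vb vc _ _ =
        contradiction (λ i → trans (b∈V0⇒a≗c vb i) (V0⁻ vc i)) (∉V0⇒nonzero va)
      cases true  false false va vb vc _ _ =
        refl , b , c , b≢c , member b (triple-y a b c) , member c (triple-z a b c) , sameGroup⁺ vb (a∈V0⇒b≗c va)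
      cases false true  false va vb vc _ _ =
        refl , a , c , a≢c , member a (triple-x a b c) , member c (triple-z a b c) , sameGroup⁺ va (b∈V0⇒a≗c vb)
      cases false false true  va vb vc _ _ =
        refl , a , b , a≢b , member a (triple-x a b c) , member b (triple-y a b c) , sameGroup⁺ va (c∈V0⇒a≗b vc)
      shape : 𝟙 (lookup V0 a) + (𝟙 (lookup V0 b) + 𝟙 (lookup V0 c)) ≡ 1 × HasSameGroupPair (triple a b c)
      shape = cases (lookup V0 a) (lookup V0 b) (lookup V0 c) refl refl refl notAll notNone

  otherBlock-triple-shape : ∀ {a b c} → a ≢ b → a ≢ c → b ≢ c → otherBlock (triple a b c) ≡ true →
                            ∣ triple a b c ∩ V0 ∣ ≡ 1 × HasSameGroupPair (triple a b c)
  otherBlock-triple-shape {a} {b} {c} a≢b a≢c b≢c other =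
    triple-meets-V0-once c≗a⊕b a≢b a≢c b≢c notAll notNone
    where
    S : Subset m
    S = triple a b c
    neither : not (insideV0 S) ∧ not (disjointV0 S) ≡ true
    neither = ∧-conicalʳ (isBlock S) (not (insideV0 S) ∧ not (disjointV0 S)) other
    c≗a⊕b : column c ≗ column a ⊕ column b
    c≗a⊕b = hasColumn⁻ (trans (sym (isBlock-triple a≢b a≢c b≢c))
                              (∧-conicalˡ (isBlock S) (not (insideV0 S) ∧ not (disjointV0 S)) other))
    notAll : lookup V0 a ∧ (lookup V0 b ∧ lookup V0 c) ≡ false
    notAll = trans (sym (insideV0-triple a≢b a≢c b≢c))
                   (not-injective (∧-conicalˡ (not (insideV0 S)) (not (disjointV0 S)) neither))
    notNone : not (lookup V0 a) ∧ (not (lookup V0 b) ∧ not (lookup V0 c)) ≡ false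
    notNone = trans (sym (disjointV0-triple a≢b a≢c b≢c))
                    (not-injective (∧-conicalʳ (not (insideV0 S)) (not (disjointV0 S)) neither))

  otherBlock-shape : ∀ B → otherBlock B ≡ true → ∣ B ∩ V0 ∣ ≡ 1 × HasSameGroupPair B
  otherBlock-shape B other = shape (triple-of B (isBlock⇒∣∣≡3 {B} isBlock-B))
    where
    isBlock-B : isBlock B ≡ true
    isBlock-B = ∧-conicalˡ (isBlock B) (not (insideV0 B) ∧ not (disjointV0 B)) other
    shape : ∃[ a ] ∃[ b ] (a ≢ b × ∃[ c ] (a ≢ c × b ≢ c × B ≡ triple a b c)) →
            ∣ B ∩ V0 ∣ ≡ 1 × HasSameGroupPair B
    shape (a , b , a≢b , c , a≢c , b≢c , B≡abc) =
      subst (λ C → ∣ C ∩ V0 ∣ ≡ 1 × HasSameGroupPair C) (sym B≡abc)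
            (otherBlock-triple-shape a≢b a≢c b≢c (subst (λ C → otherBlock C ≡ true) B≡abc other))


∑-pairs : ∀ K (g : ℕ → ℕ) → ∑[ j < 2 * K ] g (toℕ j) ≡ ∑[ q < K ] (g (toℕ q * 2) + g (suc (toℕ q * 2)))
∑-pairs zero    g = refl
∑-pairs (suc K) g = begin
  ∑[ j < 2 * suc K ] g (toℕ j)
    ≡⟨ cong (λ L → ∑[ j < L ] g (toℕ j)) (*-suc 2 K) ⟩
  g 0 + (g 1 + ∑[ j < 2 * K ] g (2 + toℕ j))
    ≡⟨ cong (λ r → g 0 + (g 1 + r)) (∑-pairs K (λ i → g (2 + i))) ⟩
  g 0 + (g 1 + rest)
    ≡⟨ +-assoc (g 0) (g 1) rest ⟨
  ∑[ q < suc K ] (g (toℕ q * 2) + g (suc (toℕ q * 2)))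
    ∎
  where
  open ≡-Reasoning
  rest : ℕ
  rest = ∑[ q < K ] (g (2 + toℕ q * 2) + g (3 + toℕ q * 2))

bitsLSB-∷ : ∀ n q b → bitsLSB (suc n) (𝟙 b + q * 2) ≡ b ∷ bitsLSB n q
bitsLSB-∷ n q false = cong₂ _∷_ (cong (_≡ᵇ 1) (m*n%n≡0 q 2)) (cong (bitsLSB n) (m*n/n≡m q 2))
bitsLSB-∷ n q true  = cong₂ _∷_ (cong (_≡ᵇ 1) ([m+kn]%n≡m%n 1 q 2)) (cong (bitsLSB n) half)
  where
  half : (1 + q * 2) / 2 ≡ q
  half = trans (+-distrib-/ 1 (q * 2) (subst (λ r → 1 + r < 2) (sym (m*n%n≡0 q 2)) (s≤s (s≤s z≤n))))
               (m*n/n≡m q 2)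

∑-bitsLSB : ∀ n (h : Vec Bool n → ℕ) → ∑[ j < 2 ^ n ] h (bitsLSB n (toℕ j)) ≡ ∑ᵛ h
∑-bitsLSB zero    h = +-identityʳ (h [])
∑-bitsLSB (suc n) h = begin
  ∑[ j < 2 * 2 ^ n ] h (bitsLSB (suc n) (toℕ j))
    ≡⟨ ∑-pairs (2 ^ n) (h ∘ bitsLSB (suc n)) ⟩
  ∑[ q < 2 ^ n ] (h (bitsLSB (suc n) (𝟙 false + toℕ q * 2)) + h (bitsLSB (suc n) (𝟙 true + toℕ q * 2)))
    ≡⟨ sum-cong-≗ {2 ^ n} (λ q → cong₂ _+_ (cong h (bitsLSB-∷ n (toℕ q) false))
                                            (cong h (bitsLSB-∷ n (toℕ q) true))) ⟩
  ∑[ q < 2 ^ n ] (h (false ∷ bitsLSB n (toℕ q)) + h (true ∷ bitsLSB n (toℕ q)))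
    ≡⟨ ∑-distrib-+ {2 ^ n} (λ q → h (false ∷ bitsLSB n (toℕ q))) (λ q → h (true ∷ bitsLSB n (toℕ q))) ⟩
  ∑[ q < 2 ^ n ] h (false ∷ bitsLSB n (toℕ q)) + ∑[ q < 2 ^ n ] h (true ∷ bitsLSB n (toℕ q))
    ≡⟨ cong₂ _+_ (∑-bitsLSB n (h ∘ (false ∷_))) (∑-bitsLSB n (h ∘ (true ∷_))) ⟩
  ∑ᵛ h
    ∎
  where open ≡-Reasoning

agrees : ∀ {n k} → (Fin k → Fin n) → (Fin k → Bool) → Vec Bool n → Bool
agrees ι u v = allᶠ (λ i → eqᵇ (lookup v (ι i)) (u i))

lookup-∷-punchOut : ∀ {n} {j : Fin (suc n)} (0≢j : zero ≢ j) b (v : Vec Bool n) →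
                    lookup (b ∷ v) j ≡ lookup v (punchOut 0≢j)
lookup-∷-punchOut 0≢j b v = cong (lookup (b ∷ v)) (sym (punchIn-punchOut 0≢j))

-- Induction on n: the first coordinate is either prescribed (one choice) or free (two choices).
∑ᵛ-agrees : ∀ {n k} (ι : Fin k → Fin n) → Injective _≡_ _≡_ ι → (u : Fin k → Bool) →
            ∑ᵛ (𝟙 ∘ agrees ι u) ≡ 2 ^ (n ∸ k)
∑ᵛ-agrees {zero}  {zero}  ι _ u = refl
∑ᵛ-agrees {zero}  {suc k} ι _ u with () ← ι zero
∑ᵛ-agrees {suc n} {k} ι ι-inj u with any? (λ i → zero ≟ᶠ ι i)
∑ᵛ-agrees {suc n} {zero}  ι ι-inj u | yes (() , _)
∑ᵛ-agrees {suc n} {suc k} ι ι-inj u | yes (i₀ , 0≡ιi₀) = begin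
  ∑ᵛ (𝟙 ∘ agrees ι u ∘ (false ∷_)) + ∑ᵛ (𝟙 ∘ agrees ι u ∘ (true ∷_))
    ≡⟨ cong₂ _+_ (∑ᵛ-cong (cong 𝟙 ∘ split false)) (∑ᵛ-cong (cong 𝟙 ∘ split true)) ⟩
  ∑ᵛ (λ v → 𝟙 (eqᵇ false (u i₀) ∧ agrees ι′ u′ v)) + ∑ᵛ (λ v → 𝟙 (eqᵇ true (u i₀) ∧ agrees ι′ u′ v))
    ≡⟨ one-choice (u i₀) ⟩
  ∑ᵛ (𝟙 ∘ agrees ι′ u′)
    ≡⟨ ∑ᵛ-agrees ι′ ι′-inj u′ ⟩
  2 ^ (n ∸ k)
    ∎
  where
  open ≡-Reasoning
  0≢ι′ : ∀ j → zero ≢ ι (punchIn i₀ j)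
  0≢ι′ j 0≡ι = punchInᵢ≢i i₀ j (ι-inj (trans (sym 0≡ι) 0≡ιi₀))
  ι′ : Fin k → Fin n
  ι′ j = punchOut (0≢ι′ j)
  ι′-inj : Injective _≡_ _≡_ ι′
  ι′-inj {i} {j} eq = punchIn-injective i₀ i j (ι-inj (punchOut-injective (0≢ι′ i) (0≢ι′ j) eq))
  u′ : Fin k → Bool
  u′ = u ∘ punchIn i₀
  split : ∀ b v → agrees ι u (b ∷ v) ≡ eqᵇ b (u i₀) ∧ agrees ι′ u′ v
  split b v = trans (∧-Sum.sum-remove {i = i₀} (λ i → eqᵇ (lookup (b ∷ v) (ι i)) (u i)))
    (cong₂ _∧_ (cong (λ j → eqᵇ (lookup (b ∷ v) j) (u i₀)) (sym 0≡ιi₀))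
               (∧-Sum.sum-cong-≗ (λ j → cong (λ c → eqᵇ c (u′ j)) (lookup-∷-punchOut (0≢ι′ j) b v))))
  one-choice : ∀ c → ∑ᵛ (λ v → 𝟙 (eqᵇ false c ∧ agrees ι′ u′ v))
                     + ∑ᵛ (λ v → 𝟙 (eqᵇ true c ∧ agrees ι′ u′ v))
                     ≡ ∑ᵛ (𝟙 ∘ agrees ι′ u′)
  one-choice false = trans (cong (∑ᵛ (𝟙 ∘ agrees ι′ u′) +_) (∑ᵛ-zero {n} {λ _ → 0} (λ _ → refl)))
                           (+-identityʳ (∑ᵛ (𝟙 ∘ agrees ι′ u′)))
  one-choice true  = cong (_+ ∑ᵛ (𝟙 ∘ agrees ι′ u′)) (∑ᵛ-zero {n} {λ _ → 0} (λ _ → refl))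
∑ᵛ-agrees {suc n} {k} ι ι-inj u | no 0∉ι = begin
  ∑ᵛ (𝟙 ∘ agrees ι u ∘ (false ∷_)) + ∑ᵛ (𝟙 ∘ agrees ι u ∘ (true ∷_))
    ≡⟨ cong₂ _+_ (∑ᵛ-cong (cong 𝟙 ∘ shift false)) (∑ᵛ-cong (cong 𝟙 ∘ shift true)) ⟩
  ∑ᵛ (𝟙 ∘ agrees ι′ u) + ∑ᵛ (𝟙 ∘ agrees ι′ u)
    ≡⟨ cong₂ _+_ (∑ᵛ-agrees ι′ ι′-inj u) (trans (∑ᵛ-agrees ι′ ι′-inj u) (sym (+-identityʳ _))) ⟩
  2 ^ suc (n ∸ k)
    ≡⟨ cong (2 ^_) (+-∸-assoc 1 (injective⇒≤ ι′-inj)) ⟨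
  2 ^ (suc n ∸ k)
    ∎
  where
  open ≡-Reasoning
  0≢ι : ∀ i → zero ≢ ι i
  0≢ι i 0≡ι = 0∉ι (i , 0≡ι)
  ι′ : Fin k → Fin n
  ι′ i = punchOut (0≢ι i)
  ι′-inj : Injective _≡_ _≡_ ι′
  ι′-inj {i} {j} eq = ι-inj (punchOut-injective (0≢ι i) (0≢ι j) eq)
  shift : ∀ b v → agrees ι u (b ∷ v) ≡ agrees ι′ u v
  shift b v = ∧-Sum.sum-cong-≗ (λ i → cong (λ c → eqᵇ c (u i)) (lookup-∷-punchOut (0≢ι i) b v))

lookup-reverse : ∀ {a} {A : Set a} {n} (xs : Vec A n) (i : Fin n) →
                 lookup (reverse xs) i ≡ lookup xs (opposite i)
lookup-reverse {A = A} xs i =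
  trans (cong (lookup (reverse xs)) (sym (opposite-involutive i))) (lookup-reverse-opposite xs (opposite i))
  where
  lookup-∷ʳ-last : ∀ {n} (xs : Vec A n) x → lookup (xs ∷ʳ x) (fromℕ n) ≡ x
  lookup-∷ʳ-last []       x = refl
  lookup-∷ʳ-last (_ ∷ xs) x = lookup-∷ʳ-last xs x
  lookup-∷ʳ-inject₁ : ∀ {n} (xs : Vec A n) x (j : Fin n) → lookup (xs ∷ʳ x) (inject₁ j) ≡ lookup xs j
  lookup-∷ʳ-inject₁ (_ ∷ xs) x zero    = refl
  lookup-∷ʳ-inject₁ (_ ∷ xs) x (suc j) = lookup-∷ʳ-inject₁ xs x j
  lookup-reverse-opposite : ∀ {n} (xs : Vec A n) (j : Fin n) → lookup (reverse xs) (opposite j) ≡ lookup xs j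
  lookup-reverse-opposite (x ∷ xs) zero    rewrite reverse-∷ x xs = lookup-∷ʳ-last (reverse xs) x
  lookup-reverse-opposite (x ∷ xs) (suc j) rewrite reverse-∷ x xs =
    trans (lookup-∷ʳ-inject₁ (reverse xs) x (opposite j)) (lookup-reverse-opposite xs j)

bitsLSB-0 : ∀ n → bitsLSB n 0 ≡ replicate n false
bitsLSB-0 zero    = refl
bitsLSB-0 (suc n) = cong (false ∷_) (bitsLSB-0 n)

opposite-injective : ∀ {n} → Injective _≡_ _≡_ (opposite {n})
opposite-injective {x = i} {j} eq =
  trans (sym (opposite-involutive i)) (trans (cong opposite eq) (opposite-involutive j))

module Columns (n t : ℕ) (κ : Fin (n ∸ t) → Fin n) (t≤n : t ≤ n) (κ-inj : Injective _≡_ _≡_ κ) where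
  open Setup n t κ using (Hnt)
  open ParityCheck Hnt using (V0; group; ∣group∣≡∑; V0≡group𝟎)

  -- Column j of H_n is the reversed n-bit expansion of j + 1, so together with the expansion
  -- of 0 the columns run through every vector of length n once.
  ∣group∣+𝟙[u≡𝟎]≡2^t : ∀ u → 𝟙 (allᶠ (λ i → eqᵇ false (u i))) + ∣ group u ∣ ≡ 2 ^ t
  ∣group∣+𝟙[u≡𝟎]≡2^t u = begin
    𝟙 (allᶠ (λ i → eqᵇ false (u i))) + ∣ group u ∣
      ≡⟨ cong₂ _+_ (cong 𝟙 (∧-Sum.sum-cong-≗ zero-column)) (∣group∣≡∑ u) ⟩
    ∑[ j < suc (2 ^ n ∸ 1) ] g (toℕ j)
      ≡⟨ cong (λ L → ∑[ j < L ] g (toℕ j)) (+-∸-assoc 1 (m^n>0 2 n)) ⟨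
    ∑[ j < 2 ^ n ] g (toℕ j)
      ≡⟨ ∑-bitsLSB n (𝟙 ∘ agrees κ u ∘ reverse) ⟩
    ∑ᵛ (𝟙 ∘ agrees κ u ∘ reverse)
      ≡⟨ ∑ᵛ-cong (λ v → cong 𝟙 (∧-Sum.sum-cong-≗ (λ i →
           cong (λ b → eqᵇ b (u i)) (lookup-reverse v (κ i))))) ⟩
    ∑ᵛ (𝟙 ∘ agrees (opposite ∘ κ) u)
      ≡⟨ ∑ᵛ-agrees (opposite ∘ κ) (κ-inj ∘ opposite-injective) u ⟩
    2 ^ (n ∸ (n ∸ t))
      ≡⟨ cong (2 ^_) (m∸[m∸n]≡n t≤n) ⟩
    2 ^ t
      ∎
    where
    open ≡-Reasoning
    g : ℕ → ℕ
    g m = 𝟙 (agrees κ u (reverse (bitsLSB n m)))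
    zero-column : ∀ i → eqᵇ false (u i) ≡ eqᵇ (lookup (reverse (bitsLSB n 0)) (κ i)) (u i)
    zero-column i = cong (λ b → eqᵇ b (u i)) (sym (begin
      lookup (reverse (bitsLSB n 0)) (κ i)         ≡⟨ lookup-reverse (bitsLSB n 0) (κ i) ⟩
      lookup (bitsLSB n 0) (opposite (κ i))        ≡⟨ cong (λ v → lookup v (opposite (κ i))) (bitsLSB-0 n) ⟩
      lookup (replicate n false) (opposite (κ i))  ≡⟨ lookup-replicate (opposite (κ i)) false ⟩
      false                                        ∎))

  ∣group∣≡2^t : ∀ u → (∃[ i ] u i ≡ true) → ∣ group u ∣ ≡ 2 ^ t
  ∣group∣≡2^t u (i , ui) = trans (cong (λ b → 𝟙 b + ∣ group u ∣) (sym u≢𝟎)) (∣group∣+𝟙[u≡𝟎]≡2^t u)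
    where
    u≢𝟎 : allᶠ (λ i → eqᵇ false (u i)) ≡ false
    u≢𝟎 = ¬-not λ u≡𝟎 → contradiction (trans (eqᵇ⇒≡ (allᶠ⁻ u≡𝟎 i)) ui) λ ()

  ∣V0∣≡2^t∸1 : ∣ V0 ∣ ≡ 2 ^ t ∸ 1
  ∣V0∣≡2^t∸1 = trans (cong ∣_∣ V0≡group𝟎)
    (cong (_∸ 1) (trans (cong (λ b → 𝟙 b + ∣ group 𝟎 ∣) (sym zero-matches-𝟎)) (∣group∣+𝟙[u≡𝟎]≡2^t 𝟎)))
    where
    zero-matches-𝟎 : allᶠ (λ i → eqᵇ false (𝟎 {n ∸ t} i)) ≡ true
    zero-matches-𝟎 = allᶠ⁺ {n ∸ t} (λ _ → refl)

strictlyMonotone⇒injective : ∀ {k n} {f : Fin k → Fin n} → (∀ i j → i <ᶠ j → f i <ᶠ f j) →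
                             Injective _≡_ _≡_ f
strictlyMonotone⇒injective {f = f} mono {i} {j} fi≡fj with <-cmp i j
... | tri< i<j _ _ = contradiction fi≡fj (<⇒≢ (mono i j i<j))
... | tri≈ _ i≡j _ = i≡j
... | tri> _ _ j<i = contradiction (sym fi≡fj) (<⇒≢ (mono j i j<i))

theorem2p7 : (n t : ℕ) → 2 ≤ n → 1 ≤ t → t < n →
    (κ : Fin (n ∸ t) → Fin n) → (∀ i j → i <ᶠ j → κ i <ᶠ κ j) →
    let open Setup n t κ in
    -- (1) blocks inside V0 = all 3-subsets of the T-set V0
    (∣ V0 ∣ ≡ T
      × (∀ (B : Subset N) → ∣ B ∣ ≡ 3 → B ⊆ V0 → isBlock B ≡ true))
    -- (2) blocks disjoint from V0: GDD with groups of size T+1, λ1 = 0, λ2 = T+1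
    × ((∀ (u : Fin (n ∸ t) → Bool) → (∃[ i ] u i ≡ true) → ∣ group u ∣ ≡ 2 ^ t)
      × (∀ (x y : Fin N) → x ≢ y → sameGroup x y ≡ true →
           countSubsets (λ B → isBlock B ∧ disjointV0 B ∧ lookup B x ∧ lookup B y) ≡ 0)
      × (∀ (x y : Fin N) → lookup V0 x ≡ false → lookup V0 y ≡ false → sameGroup x y ≡ false →
           countSubsets (λ B → isBlock B ∧ disjointV0 B ∧ lookup B x ∧ lookup B y) ≡ T + 1))
    -- (3) remaining blocks
    × ((∀ (B : Subset N) → otherBlock B ≡ true →
           ∣ B ∩ V0 ∣ ≡ 1
           × ∃[ x ] ∃[ y ] (x ≢ y × x ∈ B × y ∈ B × sameGroup x y ≡ true))
      × (∀ (x y : Fin N) → x ≢ y → sameGroup x y ≡ true →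
           countSubsets (λ B → otherBlock B ∧ lookup B x ∧ lookup B y) ≡ T))
theorem2p7 n t _ _ t<n κ κ-mono =
    (∣V0∣≡2^t∸1 , blocks-inside-V0)
  , (∣group∣≡2^t , (λ _ _ → disjoint-blocks-within-group) , blocks-across-groups)
  , (otherBlock-shape , λ _ _ x≢y same → trans (other-blocks-within-group x≢y same) ∣V0∣≡2^t∸1)
  where
  open Setup n t κ using (Hnt)
  open ParityCheck Hnt
  open Columns n t κ (<⇒≤ t<n) (strictlyMonotone⇒injective κ-mono)
  blocks-across-groups : ∀ x y → lookup V0 x ≡ false → lookup V0 y ≡ false → sameGroup x y ≡ false →
    countSubsets (λ B → isBlock B ∧ disjointV0 B ∧ lookup B x ∧ lookup B y) ≡ 2 ^ t ∸ 1 + 1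
  blocks-across-groups x y x∉V0 y∉V0 different = begin
    countSubsets (λ B → isBlock B ∧ disjointV0 B ∧ lookup B x ∧ lookup B y)
      ≡⟨ disjoint-blocks-across-groups x∉V0 y∉V0 different ⟩
    ∣ group (column x ⊕ column y) ∣
      ≡⟨ ∣group∣≡2^t (column x ⊕ column y) (sameGroup≡false⇒⊕≢𝟎 x∉V0 different) ⟩
    2 ^ t
      ≡⟨ m∸n+n≡m (m^n>0 2 t) ⟨
    2 ^ t ∸ 1 + 1
      ∎
    where open ≡-Reasoning
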